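{- Let $r\in T$ be a terminal and let $F$ be a set of edges on the vertex set $V$ such that the graph $G+F=(V,E\cup F)$ contains $\ell+1$ openly disjoint $r,t$-paths for every terminal $t\in T\setminus\{r\}$. Let $C$ be a core. If $r\in C$ or $r\in H(C)^*$, then every deficient set $U\in\mathrm{Halo}(C)$ is covered by some edge of $F$, i.e. $F$ contains an edge with one endpoint in $U$ and the other in $U^*$.
   Context: Let $G=(V,E)$ be a finite undirected graph, $T\subseteq V$ a set of terminals and $\ell\ge 0$ an integer. Standing assumptions: $T$ is $\ell$-connected in $G$ (every pair of distinct terminals is joined by $\ell$ openly disjoint paths, i.e. paths sharing only their endpoints), $|T|\ge 2\ell$, and no two terminals are adjacent in $G$. For $U\subseteq V$, let $N(U)=\{v\in V\setminus U:\exists u\in U,\ uv\in E\}$ and $U^*=V\setminus(U\cup N(U))$, both taken in $G$. A deficient set is a set $U\subseteq V$ with $U\cap T\ne\emptyset$, $U^*\cap T\neq\emptyset$ and $|N(U)|<\ell+1$. A deficient set $U$ is small if $|U\cap T|\le |U^*\cap T|$. A core is an inclusionwise minimal small deficient set. For a core $C$, $\mathrm{Halo}(C)$ is the family of all small deficient sets $U$ with $C\subseteq U$ such that no core $D\ne C$ satisfies $D\subseteq U$, and $H(C)$ is the union of all sets in $\mathrm{Halo}(C)$; $H(C)^*=V\setminus(H(C)\cup N(H(C)))$. -}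

module Defs where

open import Data.Nat using (ℕ; suc; _+_; _≤_; _<_; _*_)
open import Data.Bool using (Bool; true; false; _∨_; _∧_; not)
open import Data.Fin using (Fin)
open import Data.Fin.Subset using (Subset; _∈_; _∉_; _⊆_; _∩_; _∪_; ∁; ∣_∣; Nonempty)
open import Data.Vec using (tabulate; lookup)
open import Data.List using (List; []; _∷_; _++_)
import Data.List.Membership.Propositional as LM
open import Data.List.Relation.Unary.Linked using (Linked)
open import Data.List.Relation.Unary.Unique.Propositional using (Unique)
open import Data.Product using (Σ; ∃; ∃-syntax; _×_)
open import Data.Sum using (_⊎_)
open import Data.Empty using (⊥)
open import Relation.Nullary using (¬_)
open import Relation.Binary.PropositionalEquality using (_≡_; _≢_)

-- A (finite, undirected) graph on vertex set Fin n, given by a Boolean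
-- matrix; the undirected edge uv is present iff  g u v ∨ g v u.
Graph : ℕ → Set
Graph n = Fin n → Fin n → Bool

adj : ∀ {n} → Graph n → Fin n → Fin n → Bool
adj g u v = g u v ∨ g v u

_⊕_ : ∀ {n} → Graph n → Graph n → Graph n
(g ⊕ f) u v = g u v ∨ f u v

anyFin : ∀ {n} → (Fin n → Bool) → Bool
anyFin {ℕ.zero} p = false
anyFin {suc n} p = p Fin.zero ∨ anyFin (λ i → p (Fin.suc i))

N : ∀ {n} → Graph n → Subset n → Subset n
N g U = tabulate (λ v → not (lookup U v) ∧ anyFin (λ u → lookup U u ∧ adj g u v))


star : ∀ {n} → Graph n → Subset n → Subset n
star g U = ∁ (U ∪ N g U)

IsPath : ∀ {n} → Graph n → Fin n → List (Fin n) → Fin n → Set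
IsPath g s xs t =
  Unique (s ∷ xs ++ t ∷ []) × Linked (λ u v → adj g u v ≡ true) (s ∷ xs ++ t ∷ [])

OpenlyDisjoint : ∀ {n} → Graph n → Fin n → Fin n → ℕ → Set
OpenlyDisjoint {n} g s t k =
  Σ (Fin k → List (Fin n)) λ P →
    (∀ i → IsPath g s (P i) t) ×
    (∀ i j → i ≢ j → (P i ≢ P j) × (∀ v → v LM.∈ P i → v LM.∈ P j → ⊥))

Connected : ∀ {n} → Graph n → Subset n → ℕ → Set
Connected g T ℓ = ∀ s t → s ∈ T → t ∈ T → s ≢ t → OpenlyDisjoint g s t ℓ

Deficient : ∀ {n} → Graph n → Subset n → ℕ → Subset n → Set
Deficient g T ℓ U =
  Nonempty (U ∩ T) × Nonempty (star g U ∩ T) × ∣ N g U ∣ < ℓ + 1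

SmallDeficient : ∀ {n} → Graph n → Subset n → ℕ → Subset n → Set
SmallDeficient g T ℓ U = Deficient g T ℓ U × ∣ U ∩ T ∣ ≤ ∣ star g U ∩ T ∣

Core : ∀ {n} → Graph n → Subset n → ℕ → Subset n → Set
Core g T ℓ C =
  SmallDeficient g T ℓ C × (∀ U → SmallDeficient g T ℓ U → U ⊆ C → U ≡ C)

InHalo : ∀ {n} → Graph n → Subset n → ℕ → Subset n → Subset n → Set
InHalo g T ℓ C U =
  SmallDeficient g T ℓ U × C ⊆ U × (∀ D → Core g T ℓ D → D ⊆ U → D ≡ C)

InH : ∀ {n} → Graph n → Subset n → ℕ → Subset n → Fin n → Set
InH g T ℓ C v = ∃[ U ] (InHalo g T ℓ C U × v ∈ U)

InNH : ∀ {n} → Graph n → Subset n → ℕ → Subset n → Fin n → Set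
InNH g T ℓ C v = ¬ InH g T ℓ C v × ∃[ u ] (InH g T ℓ C u × adj g u v ≡ true)

InHStar : ∀ {n} → Graph n → Subset n → ℕ → Subset n → Fin n → Set
InHStar g T ℓ C v = ¬ InH g T ℓ C v × ¬ InNH g T ℓ C v

Covers : ∀ {n} → Graph n → Graph n → Subset n → Set
Covers g f U = ∃[ u ] ∃[ v ] (adj f u v ≡ true × u ∈ U × v ∈ star g U)

-- If r ∈ C ⊆ U, pick a terminal t ∈ U*; if r ∈ H(C)*, then r ∈ U* and we pick a
-- terminal t ∈ U. Either way r and t lie on opposite sides of the separator N(U),
-- in which there are at most ℓ vertices. Each of the ℓ + 1 openly disjoint r,t-paths
-- in G + F either passes through N(U) or jumps directly between U and U*; such a
-- jump cannot be an edge of G, so it is an edge of F covering U. By pigeonhole at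
-- least one path avoids N(U).
module Submission where

open import Defs
open import Data.Nat using (ℕ; _≤_; _*_; _+_; _<_)
open import Data.Nat.Properties using (<-irrefl)
open import Data.Bool using (Bool; true; false; _∧_; not)
open import Data.Bool.Properties using (∨-zeroʳ; ∨-comm)
open import Data.Fin using (Fin; zero; suc)
open import Data.Fin.Properties using (suc-injective; pigeonhole)
open import Data.Fin.Subset using (Subset; _∈_; _∉_; ∣_∣; inside; outside)
open import Data.Fin.Subset.Properties using (_∈?_; x∈p∪q⁺; x∈p∪q⁻; x∉p⇒x∈∁p; x∈∁p⇒x∉p; x∈p∩q⁻)
open import Data.Vec using (_∷_; here; there; lookup; tabulate)
open import Data.Vec.Properties using (lookup⇒[]=; []=⇒lookup; lookup∘tabulate)
open import Data.List using (List; []; _∷_; _++_)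
open import Data.List.Membership.Propositional using (find) renaming (_∈_ to _∈ₗ_)
open import Data.List.Relation.Unary.Any using (Any; here; there)
open import Data.List.Relation.Unary.Linked using (Linked; _∷_)
open import Data.Product using (∃-syntax; _×_; _,_; proj₁; proj₂)
open import Data.Sum using (_⊎_; inj₁; inj₂; [_,_]′; map₂)
open import Data.Empty using (⊥-elim)
open import Relation.Nullary using (yes; no)
open import Function using (_∘_)
open import Relation.Binary.PropositionalEquality using (_≡_; _≢_; refl; sym; trans; cong; cong₂)

private
  variable
    n : ℕ

∧-true⁻ : ∀ {x y} → x ∧ y ≡ true → x ≡ true × y ≡ true
∧-true⁻ {true} refl = refl , refl

anyFin⁺ : (p : Fin n → Bool) (i : Fin n) → p i ≡ true → anyFin p ≡ true
anyFin⁺ p zero pi rewrite pi = refl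
anyFin⁺ p (suc i) pi rewrite anyFin⁺ (λ k → p (suc k)) i pi = ∨-zeroʳ (p zero)

anyFin⁻ : (p : Fin n → Bool) → anyFin p ≡ true → ∃[ i ] p i ≡ true
anyFin⁻ {ℕ.zero}  p ()
anyFin⁻ {ℕ.suc n} p any with p zero in p0
... | true  = zero , p0
... | false with anyFin⁻ (λ k → p (suc k)) any
...   | i , pi = suc i , pi

∈-index : {S : Subset n} {x : Fin n} → x ∈ S → Fin ∣ S ∣
∈-index {S = inside  ∷ S} here        = zero
∈-index {S = inside  ∷ S} (there x∈S) = suc (∈-index x∈S)
∈-index {S = outside ∷ S} (there x∈S) = ∈-index x∈S

∈-index-injective : {S : Subset n} {x y : Fin n} (x∈S : x ∈ S) (y∈S : y ∈ S) →
  ∈-index x∈S ≡ ∈-index y∈S → x ≡ y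
∈-index-injective {S = inside  ∷ S} here        here        _  = refl
∈-index-injective {S = inside  ∷ S} (there x∈S) (there y∈S) eq =
  cong suc (∈-index-injective x∈S y∈S (suc-injective eq))
∈-index-injective {S = outside ∷ S} (there x∈S) (there y∈S) eq =
  cong suc (∈-index-injective x∈S y∈S eq)

some-or-all : {A : Set} {k : ℕ} {B : Fin k → Set} → (∀ i → A ⊎ B i) → A ⊎ (∀ i → B i)
some-or-all {k = ℕ.zero}  h = inj₂ λ ()
some-or-all {k = ℕ.suc k} h with h zero | some-or-all (λ i → h (suc i))
... | inj₁ a  | _        = inj₁ a
... | inj₂ _  | inj₁ a   = inj₁ a
... | inj₂ b₀ | inj₂ bₛ  = inj₂ λ { zero → b₀ ; (suc i) → bₛ i }

pigeonhole-Any : {k : ℕ} (X : Subset n) (P : Fin k → List (Fin n)) → ∣ X ∣ < k →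
  (∀ i → Any (_∈ X) (P i)) → ∃[ i ] ∃[ j ] (i ≢ j × ∃[ v ] (v ∈ₗ P i × v ∈ₗ P j))
pigeonhole-Any X P |X|<k hits
  with i , j , i<j , same-index ← pigeonhole |X|<k (λ i → ∈-index (proj₂ (proj₂ (find (hits i)))))
  with find (hits i) | find (hits j)
... | v , v∈Pi , v∈X | w , w∈Pj , w∈X
  with refl ← ∈-index-injective v∈X w∈X same-index
  = i , j , (λ { refl → <-irrefl refl i<j }) , v , v∈Pi , w∈Pj

openlyDisjoint-avoids : {A : Set} {g : Graph n} {s t : Fin n} {k : ℕ} (X : Subset n) →
  ∣ X ∣ < k → OpenlyDisjoint g s t k →
  (∀ xs → IsPath g s xs t → A ⊎ Any (_∈ X) xs) → A
openlyDisjoint-avoids X |X|<k (P , paths , disjoint) escape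
  with some-or-all (λ i → escape (P i) (paths i))
... | inj₁ a    = a
... | inj₂ hits =
  let i , j , i≢j , v , v∈Pi , v∈Pj = pigeonhole-Any X P |X|<k hits
  in ⊥-elim (proj₂ (disjoint i j i≢j) v v∈Pi v∈Pj)

lookup-∉ : {U : Subset n} {v : Fin n} → v ∉ U → lookup U v ≡ outside
lookup-∉ {U = U} {v} v∉U with lookup U v in eq
... | inside  = ⊥-elim (v∉U (lookup⇒[]= v U eq))
... | outside = refl

adj-sym : (g : Graph n) {u v : Fin n} → adj g u v ≡ true → adj g v u ≡ true
adj-sym g {u} {v} uv = trans (∨-comm (g v u) (g u v)) uv

adj-⊕⁻ : (g f : Graph n) (u v : Fin n) → adj (g ⊕ f) u v ≡ true →
  adj g u v ≡ true ⊎ adj f u v ≡ true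
adj-⊕⁻ g f u v uv with g u v | f u v | g v u | f v u
adj-⊕⁻ g f u v uv  | true  | _     | _     | _     = inj₁ refl
adj-⊕⁻ g f u v uv  | false | true  | _     | _     = inj₂ refl
adj-⊕⁻ g f u v uv  | false | false | true  | _     = inj₁ refl
adj-⊕⁻ g f u v uv  | false | false | false | true  = inj₂ refl
adj-⊕⁻ g f u v ()  | false | false | false | false

Separated : Graph n → Subset n → Fin n → Fin n → Set
Separated g U s t = (s ∈ U × t ∈ star g U) ⊎ (s ∈ star g U × t ∈ U)

module _ (g : Graph n) {U : Subset n} where

  ∈N⁺ : {u v : Fin n} → u ∈ U → v ∉ U → adj g u v ≡ true → v ∈ N g U
  ∈N⁺ {u} {v} u∈U v∉U uv = lookup⇒[]= v (N g U) (trans (lookup∘tabulate _ v) v∈N)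
    where
    v∈N : not (lookup U v) ∧ anyFin (λ w → lookup U w ∧ adj g w v) ≡ true
    v∈N rewrite lookup-∉ v∉U = anyFin⁺ _ u (cong₂ _∧_ ([]=⇒lookup u∈U) uv)

  ∈N⁻ : {v : Fin n} → v ∈ N g U → ∃[ u ] (u ∈ U × adj g u v ≡ true)
  ∈N⁻ {v} v∈N
    with u , uv ← anyFin⁻ _ (proj₂ (∧-true⁻ (trans (sym (lookup∘tabulate _ v)) ([]=⇒lookup v∈N))))
    = u , lookup⇒[]= u U (proj₁ (∧-true⁻ uv)) , proj₂ (∧-true⁻ uv)

  star⇒∉ : {v : Fin n} → v ∈ star g U → v ∉ U
  star⇒∉ v∈U* v∈U = x∈∁p⇒x∉p v∈U* (x∈p∪q⁺ (inj₁ v∈U))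

  star⇒∉N : {v : Fin n} → v ∈ star g U → v ∉ N g U
  star⇒∉N v∈U* v∈N = x∈∁p⇒x∉p v∈U* (x∈p∪q⁺ (inj₂ v∈N))

  ∉N⇒star : {v : Fin n} → v ∉ U → v ∉ N g U → v ∈ star g U
  ∉N⇒star v∉U v∉N = x∉p⇒x∈∁p λ v∈U∪N → [ v∉U , v∉N ]′ (x∈p∪q⁻ _ _ v∈U∪N)

  separated⇒≢ : {s t : Fin n} → Separated g U s t → s ≢ t
  separated⇒≢ (inj₁ (s∈U , s∈U*)) refl = star⇒∉ s∈U* s∈U
  separated⇒≢ (inj₂ (s∈U* , s∈U)) refl = star⇒∉ s∈U* s∈U

  separated-through : {s t : Fin n} → Separated g U s t → (y : Fin n) →
    y ∈ N g U ⊎ Separated g U s y ⊎ Separated g U y t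
  separated-through sep y with y ∈? U | y ∈? N g U
  separated-through (inj₁ (_ , t∈U*)) y | yes y∈U | _      = inj₂ (inj₂ (inj₁ (y∈U , t∈U*)))
  separated-through (inj₂ (s∈U* , _)) y | yes y∈U | _      = inj₂ (inj₁ (inj₂ (s∈U* , y∈U)))
  separated-through _                 y | no _    | yes y∈N = inj₁ y∈N
  separated-through (inj₁ (s∈U , _))  y | no y∉U  | no y∉N  =
    inj₂ (inj₁ (inj₁ (s∈U , ∉N⇒star y∉U y∉N)))
  separated-through (inj₂ (_ , t∈U))  y | no y∉U  | no y∉N  =
    inj₂ (inj₂ (inj₂ (∉N⇒star y∉U y∉N , t∈U)))

  module _ (f : Graph n) where

    crossing-edge-covers : {u v : Fin n} → u ∈ U → v ∈ star g U →
      adj (g ⊕ f) u v ≡ true → Covers g f U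
    crossing-edge-covers {u} {v} u∈U v∈U* uv with adj-⊕⁻ g f u v uv
    ... | inj₁ uv∈g = ⊥-elim (star⇒∉N v∈U* (∈N⁺ u∈U (star⇒∉ v∈U*) uv∈g))
    ... | inj₂ uv∈f = u , v , uv∈f , u∈U , v∈U*

    separated-edge-covers : {u v : Fin n} → Separated g U u v →
      adj (g ⊕ f) u v ≡ true → Covers g f U
    separated-edge-covers (inj₁ (u∈U , v∈U*)) uv = crossing-edge-covers u∈U v∈U* uv
    separated-edge-covers (inj₂ (u∈U* , v∈U)) uv =
      crossing-edge-covers v∈U u∈U* (adj-sym (g ⊕ f) uv)

    path-crosses : {s t : Fin n} {xs : List (Fin n)} → Separated g U s t →
      Linked (λ u v → adj (g ⊕ f) u v ≡ true) (s ∷ xs ++ t ∷ []) →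
      Covers g f U ⊎ Any (_∈ N g U) xs
    path-crosses {xs = []}     sep (st ∷ _) = inj₁ (separated-edge-covers sep st)
    path-crosses {xs = y ∷ ys} sep (sy ∷ path) with separated-through sep y
    ... | inj₁ y∈N              = inj₂ (here y∈N)
    ... | inj₂ (inj₁ sep-sy)    = inj₁ (separated-edge-covers sep-sy sy)
    ... | inj₂ (inj₂ sep-yt)    = map₂ there (path-crosses sep-yt path)

    separated-covered : {s t : Fin n} {k : ℕ} → Separated g U s t →
      ∣ N g U ∣ < k → OpenlyDisjoint (g ⊕ f) s t k → Covers g f U
    separated-covered sep |N|<k paths =
      openlyDisjoint-avoids {g = g ⊕ f} (N g U) |N|<k paths λ _ path →
        path-crosses sep (proj₂ path)

module _ (G : Graph n) (T : Subset n) (ℓ : ℕ) {C U : Subset n} (U∈Halo : InHalo G T ℓ C U) where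

  HStar⇒star : {r : Fin n} → InHStar G T ℓ C r → r ∈ star G U
  HStar⇒star (r∉H , r∉NH) = ∉N⇒star G (λ r∈U → r∉H (U , U∈Halo , r∈U)) λ r∈N →
    let u , u∈U , ur = ∈N⁻ G r∈N in r∉NH (r∉H , u , (U , U∈Halo , u∈U) , ur)

  separated-terminal : {r : Fin n} → r ∈ C ⊎ InHStar G T ℓ C r →
    ∃[ t ] (t ∈ T × Separated G U r t)
  separated-terminal (inj₁ r∈C) =
    let ((_ , (t , t∈U*∩T) , _) , _) , C⊆U , _ = U∈Halo
    in t , proj₂ (x∈p∩q⁻ _ T t∈U*∩T) , inj₁ (C⊆U r∈C , proj₁ (x∈p∩q⁻ _ T t∈U*∩T))
  separated-terminal (inj₂ r∈H*) =
    let (((t , t∈U∩T) , _) , _) , _ = U∈Halo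
    in t , proj₂ (x∈p∩q⁻ U T t∈U∩T) , inj₂ (HStar⇒star r∈H* , proj₁ (x∈p∩q⁻ U T t∈U∩T))

lemma10 : ∀ {n} (G : Graph n) (T : Subset n) (ℓ : ℕ) →
    Connected G T ℓ →
    2 * ℓ ≤ ∣ T ∣ →
    (∀ u v → u ∈ T → v ∈ T → adj G u v ≡ false) →
    (r : Fin n) → r ∈ T →
    (F : Graph n) →
    (∀ t → t ∈ T → t ≢ r → OpenlyDisjoint (G ⊕ F) r t (ℓ + 1)) →
    (C : Subset n) → Core G T ℓ C →
    (r ∈ C ⊎ InHStar G T ℓ C r) →
    ∀ U → InHalo G T ℓ C U → Covers G F U
lemma10 G T ℓ _ _ _ r _ F paths C _ r∈C⊎H* U U∈Halo@(((_ , _ , |N|<ℓ+1) , _) , _)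
  with t , t∈T , sep ← separated-terminal G T ℓ U∈Halo r∈C⊎H*
  = separated-covered G F sep |N|<ℓ+1 (paths t t∈T (separated⇒≢ G sep ∘ sym))
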